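{- Let $\alpha_1,\alpha_2,\beta_1,\beta_2$ be strictly positive rationals and let $v_1=\alpha_1(-1,0,1,0)$, $v_2=\alpha_2(0,1,0,-1)$, $u_1=\beta_1(1,0,-1,0)$, $u_2=\beta_2(0,-1,0,1)$. For $m,n\in\mathbb{Q}$ let $x(m,n)=(x_1,x_2,x_3,x_4)=m(v_1+v_2)+n(u_1+u_2)$. Then the following are equivalent: (1) $\frac{\beta_1}{\alpha_1}=\frac{\beta_2}{\alpha_2}$; (2) for all non-negative rationals $m,n$, $\max(\min(x_1,x_2),\min(x_3,x_4))\le0$. -}

module Defs where

open import Data.Rational using (ℚ; _+_; _*_; -_; 0ℚ; 1ℚ; _÷_; Positive)
open import Data.Rational.Properties using (pos⇒nonZero)

record Q4 : Set where
  constructor ⟨_,_,_,_⟩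
  field
    c₁ c₂ c₃ c₄ : ℚ
open Q4 public

infixl 6 _⊕_
infixl 7 _·_

_⊕_ : Q4 → Q4 → Q4
⟨ a , b , c , d ⟩ ⊕ ⟨ a' , b' , c' , d' ⟩ = ⟨ a + a' , b + b' , c + c' , d + d' ⟩

_·_ : ℚ → Q4 → Q4
k · ⟨ a , b , c , d ⟩ = ⟨ k * a , k * b , k * c , k * d ⟩

-1ℚ : ℚ
-1ℚ = - 1ℚ

v₁ v₂ u₁ u₂ : ℚ → Q4
v₁ α = α · ⟨ -1ℚ , 0ℚ , 1ℚ , 0ℚ ⟩
v₂ α = α · ⟨ 0ℚ , 1ℚ , 0ℚ , -1ℚ ⟩
u₁ β = β · ⟨ 1ℚ , 0ℚ , -1ℚ , 0ℚ ⟩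
u₂ β = β · ⟨ 0ℚ , -1ℚ , 0ℚ , 1ℚ ⟩

x : (α₁ α₂ β₁ β₂ m n : ℚ) → Q4
x α₁ α₂ β₁ β₂ m n = m · (v₁ α₁ ⊕ v₂ α₂) ⊕ n · (u₁ β₁ ⊕ u₂ β₂)

_÷⁺_ : (p q : ℚ) → .{{Positive q}} → ℚ
p ÷⁺ q = (p ÷ q) {{pos⇒nonZero q}}

-- The point x(m,n) is (a, b, -a, -b) with a = n β₁ - m α₁ and b = m α₂ - n β₂, so the bound
-- says that a and b never share a strict sign.  Since α₂ a + α₁ b = n (β₁ α₂ - β₂ α₁), equal
-- ratios make a and b a zero combination with positive weights, hence of opposite signs.
-- Conversely, at the mediant point m = β₁ + β₂, n = α₁ + α₂ both a and b equal
-- D = β₁ α₂ - β₂ α₁, and the bound max(D, -D) ≤ 0 forces D = 0.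
module Submission where

open import Defs
open import Data.Rational using (ℚ; _≤_; _⊔_; _⊓_; 0ℚ; 1ℚ; Positive; NonNegative; NonZero; _+_; _*_; -_; _-_; _÷_; 1/_; positive)
open import Data.Rational.Properties
open import Data.Rational.Solver using (module +-*-Solver)
open import Algebra.Properties.Group +-0-group using (⁻¹-involutive; x∙y⁻¹≈ε⇒x≈y)
open import Relation.Binary.PropositionalEquality
open import Relation.Nullary using (yes; no; contradiction)
open import Function.Bundles using (_⇔_; mk⇔; module Equivalence)
open import Function.Properties.Equivalence using () renaming (trans to ⇔-trans; sym to ⇔-sym)
open +-*-Solver

÷-*-cancel : ∀ p q .{{_ : NonZero q}} → p ÷ q * q ≡ p
÷-*-cancel p q = begin
  p * 1/ q * q   ≡⟨ *-assoc p (1/ q) q ⟩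
  p * (1/ q * q) ≡⟨ cong (p *_) (*-inverseˡ q) ⟩
  p * 1ℚ         ≡⟨ *-identityʳ p ⟩
  p              ∎
  where open ≡-Reasoning

*-÷-cancel : ∀ p q .{{_ : NonZero q}} → p * q ÷ q ≡ p
*-÷-cancel p q = begin
  p * q * 1/ q   ≡⟨ *-assoc p q (1/ q) ⟩
  p * (q * 1/ q) ≡⟨ cong (p *_) (*-inverseʳ q) ⟩
  p * 1ℚ         ≡⟨ *-identityʳ p ⟩
  p              ∎
  where open ≡-Reasoning

÷-cross : ∀ p q r s .{{_ : NonZero q}} .{{_ : NonZero s}} → p ÷ q ≡ r ÷ s ⇔ p * s ≡ r * q
÷-cross p q r s = mk⇔ cross⇒ cross⇐
  where
  open ≡-Reasoning
  cross⇒ : p ÷ q ≡ r ÷ s → p * s ≡ r * q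
  cross⇒ eq = begin
    p * s             ≡⟨ cong (_* s) (sym (÷-*-cancel p q)) ⟩
    p ÷ q * q * s     ≡⟨ cong (λ t → t * q * s) eq ⟩
    r ÷ s * q * s     ≡⟨ solve 4 (λ r' i q' s' → r' :* i :* q' :* s' := r' :* i :* s' :* q') refl r (1/ s) q s ⟩
    r ÷ s * s * q     ≡⟨ cong (_* q) (÷-*-cancel r s) ⟩
    r * q             ∎
  cross⇐ : p * s ≡ r * q → p ÷ q ≡ r ÷ s
  cross⇐ eq = begin
    p ÷ q             ≡⟨ sym (*-÷-cancel (p ÷ q) s) ⟩
    p ÷ q * s ÷ s     ≡⟨ cong (_÷ s) (solve 4 (λ p' i s' j → p' :* i :* s' := p' :* s' :* i) refl p (1/ q) s (1/ s)) ⟩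
    p * s ÷ q ÷ s     ≡⟨ cong (λ t → t ÷ q ÷ s) eq ⟩
    r * q ÷ q ÷ s     ≡⟨ cong (_÷ s) (*-÷-cancel r q) ⟩
    r ÷ s             ∎

pos-combination≡0⇒⊓≤0 : ∀ p q a b .{{_ : Positive p}} .{{_ : Positive q}} →
                        p * a + q * b ≡ 0ℚ → a ⊓ b ≤ 0ℚ
pos-combination≡0⇒⊓≤0 p q a b eq with a ≤? 0ℚ | b ≤? 0ℚ
... | yes a≤0 | _       = ≤-trans (p⊓q≤p a b) a≤0
... | no _    | yes b≤0 = ≤-trans (p⊓q≤q a b) b≤0
... | no a≰0  | no b≰0  = contradiction (sym eq) (<⇒≢ (positive⁻¹ (p * a + q * b) {{combination>0}}))
  where
  instance
    a>0 : Positive a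
    a>0 = positive (≰⇒> a≰0)
    b>0 : Positive b
    b>0 = positive (≰⇒> b≰0)
  combination>0 : Positive (p * a + q * b)
  combination>0 = pos+pos⇒pos (p * a) {{pos*pos⇒pos p a}} (q * b) {{pos*pos⇒pos q b}}

antipodal : ℚ → ℚ → Q4
antipodal a b = ⟨ a , b , - a , - b ⟩

maxmin : Q4 → ℚ
maxmin p = (c₁ p ⊓ c₂ p) ⊔ (c₃ p ⊓ c₄ p)

pos-combination≡0⇒maxmin-antipodal≤0 : ∀ p q a b .{{_ : Positive p}} .{{_ : Positive q}} →
                                       p * a + q * b ≡ 0ℚ → maxmin (antipodal a b) ≤ 0ℚ
pos-combination≡0⇒maxmin-antipodal≤0 p q a b eq =
  ⊔-lub (pos-combination≡0⇒⊓≤0 p q a b eq) (pos-combination≡0⇒⊓≤0 p q (- a) (- b) neg-eq)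
  where
  neg-eq : p * - a + q * - b ≡ 0ℚ
  neg-eq = trans (solve 4 (λ p' q' a' b' → p' :* (:- a') :+ q' :* (:- b') := :- (p' :* a' :+ q' :* b'))
                          refl p q a b)
                 (cong -_ eq)

maxmin-antipodal-diagonal≤0⇒≡0 : ∀ d → maxmin (antipodal d d) ≤ 0ℚ → d ≡ 0ℚ
maxmin-antipodal-diagonal≤0⇒≡0 d bound = ≤-antisym d≤0 0≤d
  where
  d≤0 : d ≤ 0ℚ
  d≤0 = ≤-trans (subst (_≤ maxmin (antipodal d d)) (⊓-idem d) (p≤p⊔q (d ⊓ d) (- d ⊓ - d))) bound
  -d≤0 : - d ≤ 0ℚ
  -d≤0 = ≤-trans (subst (_≤ maxmin (antipodal d d)) (⊓-idem (- d)) (p≤q⊔p (d ⊓ d) (- d ⊓ - d))) bound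
  0≤d : 0ℚ ≤ d
  0≤d = subst (0ℚ ≤_) (⁻¹-involutive d) (neg-antimono-≤ -d≤0)

p-q≡0⇔p≡q : ∀ p q → p - q ≡ 0ℚ ⇔ p ≡ q
p-q≡0⇔p≡q p q = mk⇔ (x∙y⁻¹≈ε⇒x≈y p q) (λ { refl → +-inverseʳ p })

Q4-cong : ∀ {a b c d a' b' c' d'} → a ≡ a' → b ≡ b' → c ≡ c' → d ≡ d' →
          ⟨ a , b , c , d ⟩ ≡ ⟨ a' , b' , c' , d' ⟩
Q4-cong refl refl refl refl = refl

module _ (α₁ α₂ β₁ β₂ : ℚ) where

  x≡antipodal : ∀ m n → x α₁ α₂ β₁ β₂ m n ≡ antipodal (n * β₁ - m * α₁) (m * α₂ - n * β₂)
  x≡antipodal m n = Q4-cong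
    (solve 6 (λ a₁ a₂ b₁ b₂ m' n' →
      m' :* (a₁ :* (:- con 1ℚ) :+ a₂ :* con 0ℚ) :+ n' :* (b₁ :* con 1ℚ :+ b₂ :* con 0ℚ)
      := n' :* b₁ :- m' :* a₁) refl α₁ α₂ β₁ β₂ m n)
    (solve 6 (λ a₁ a₂ b₁ b₂ m' n' →
      m' :* (a₁ :* con 0ℚ :+ a₂ :* con 1ℚ) :+ n' :* (b₁ :* con 0ℚ :+ b₂ :* (:- con 1ℚ))
      := m' :* a₂ :- n' :* b₂) refl α₁ α₂ β₁ β₂ m n)
    (solve 6 (λ a₁ a₂ b₁ b₂ m' n' →
      m' :* (a₁ :* con 1ℚ :+ a₂ :* con 0ℚ) :+ n' :* (b₁ :* (:- con 1ℚ) :+ b₂ :* con 0ℚ)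
      := :- (n' :* b₁ :- m' :* a₁)) refl α₁ α₂ β₁ β₂ m n)
    (solve 6 (λ a₁ a₂ b₁ b₂ m' n' →
      m' :* (a₁ :* con 0ℚ :+ a₂ :* (:- con 1ℚ)) :+ n' :* (b₁ :* con 0ℚ :+ b₂ :* con 1ℚ)
      := :- (m' :* a₂ :- n' :* b₂)) refl α₁ α₂ β₁ β₂ m n)

  weighted-sum-of-coordinates : ∀ m n →
    α₂ * (n * β₁ - m * α₁) + α₁ * (m * α₂ - n * β₂) ≡ n * (β₁ * α₂ - β₂ * α₁)
  weighted-sum-of-coordinates m n = solve 6 (λ a₁ a₂ b₁ b₂ m' n' →
    a₂ :* (n' :* b₁ :- m' :* a₁) :+ a₁ :* (m' :* a₂ :- n' :* b₂) := n' :* (b₁ :* a₂ :- b₂ :* a₁))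
    refl α₁ α₂ β₁ β₂ m n

  x-at-mediant : x α₁ α₂ β₁ β₂ (β₁ + β₂) (α₁ + α₂)
                 ≡ antipodal (β₁ * α₂ - β₂ * α₁) (β₁ * α₂ - β₂ * α₁)
  x-at-mediant = trans (x≡antipodal (β₁ + β₂) (α₁ + α₂)) (cong₂ antipodal
    (solve 4 (λ a₁ a₂ b₁ b₂ → (a₁ :+ a₂) :* b₁ :- (b₁ :+ b₂) :* a₁ := b₁ :* a₂ :- b₂ :* a₁)
      refl α₁ α₂ β₁ β₂)
    (solve 4 (λ a₁ a₂ b₁ b₂ → (b₁ :+ b₂) :* a₂ :- (a₁ :+ a₂) :* b₂ := b₁ :* a₂ :- b₂ :* a₁)
      refl α₁ α₂ β₁ β₂))

lemma14 : (α₁ α₂ β₁ β₂ : ℚ) → .{{_ : Positive α₁}} → .{{_ : Positive α₂}}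
          → .{{_ : Positive β₁}} → .{{_ : Positive β₂}}
          → (β₁ ÷⁺ α₁ ≡ β₂ ÷⁺ α₂)
            ⇔ ((m n : ℚ) → NonNegative m → NonNegative n
               → let p = x α₁ α₂ β₁ β₂ m n
                 in (c₁ p ⊓ c₂ p) ⊔ (c₃ p ⊓ c₄ p) ≤ 0ℚ)
lemma14 α₁ α₂ β₁ β₂ = mk⇔ bounded tight
  where
  instance
    α₁≢0 : NonZero α₁
    α₁≢0 = pos⇒nonZero α₁
    α₂≢0 : NonZero α₂
    α₂≢0 = pos⇒nonZero α₂
  D : ℚ
  D = β₁ * α₂ - β₂ * α₁
  ratios≡⇔D≡0 : β₁ ÷ α₁ ≡ β₂ ÷ α₂ ⇔ D ≡ 0ℚ
  ratios≡⇔D≡0 = ⇔-trans (÷-cross β₁ α₁ β₂ α₂) (⇔-sym (p-q≡0⇔p≡q (β₁ * α₂) (β₂ * α₁)))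

  bounded : β₁ ÷ α₁ ≡ β₂ ÷ α₂ → ∀ m n → NonNegative m → NonNegative n →
            maxmin (x α₁ α₂ β₁ β₂ m n) ≤ 0ℚ
  bounded ratios≡ m n _ _ = subst (λ p → maxmin p ≤ 0ℚ) (sym (x≡antipodal α₁ α₂ β₁ β₂ m n))
    (pos-combination≡0⇒maxmin-antipodal≤0 α₂ α₁ (n * β₁ - m * α₁) (m * α₂ - n * β₂) (begin
      α₂ * (n * β₁ - m * α₁) + α₁ * (m * α₂ - n * β₂) ≡⟨ weighted-sum-of-coordinates α₁ α₂ β₁ β₂ m n ⟩
      n * D                                           ≡⟨ cong (n *_) (Equivalence.to ratios≡⇔D≡0 ratios≡) ⟩
      n * 0ℚ                                          ≡⟨ *-zeroʳ n ⟩
      0ℚ                                              ∎))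
    where open ≡-Reasoning

  tight : (∀ m n → NonNegative m → NonNegative n → maxmin (x α₁ α₂ β₁ β₂ m n) ≤ 0ℚ) →
          β₁ ÷ α₁ ≡ β₂ ÷ α₂
  tight bound = Equivalence.from ratios≡⇔D≡0 (maxmin-antipodal-diagonal≤0⇒≡0 D
    (subst (λ p → maxmin p ≤ 0ℚ) (x-at-mediant α₁ α₂ β₁ β₂)
      (bound (β₁ + β₂) (α₁ + α₂) (pos⇒nonNeg (β₁ + β₂) {{pos+pos⇒pos β₁ β₂}}) (pos⇒nonNeg (α₁ + α₂) {{pos+pos⇒pos α₁ α₂}}))))
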